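{- Let $\vdash$ be a regular entailment relation for an ordered group $G$, let $A,B\in\mathrm{P}_{\mathrm{fe}}^*(G)$, $x\in G$, and integers $0\le p\le q$. If $A,A+px\vdash B$ holds, or merely $A,A+px,A+qx\vdash B$, then $A,A+qx\vdash B$ holds.
   Context: Groups are commutative; an ordered group is a commutative group with a partial order $\le_G$ compatible with addition. $\mathrm{P}_{\mathrm{fe}}^*(G)$ is the set of nonempty finite subsets of $G$; $a$ stands for $\{a\}$, $A,A'$ for $A\cup A'$, $y+A=\{y+a\}$. An unbounded entailment relation on $G$ is a relation $\vdash$ on $\mathrm{P}_{\mathrm{fe}}^*(G)$ with $a\vdash a$; $A\vdash B\Rightarrow A,A'\vdash B,B'$; ($A\vdash B,c$ and $A,c\vdash B$) $\Rightarrow A\vdash B$. It is regular if moreover $a\le_G b\Rightarrow a\vdash b$; $A\vdash B\Rightarrow y+A\vdash y+B$ for all $y\in G$; and $y+a,z+b\vdash z+a,y+b$ for all $a,b,y,z\in G$. -}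

module Defs where

open import Level using (Level; _⊔_; suc)
open import Data.Nat using (ℕ; zero; suc)
open import Data.List.NonEmpty using (List⁺; [_]; _⁺++⁺_; toList) renaming (map to map⁺)
open import Data.List.Relation.Unary.Any using (Any)
open import Data.List.Relation.Unary.All using (All)
open import Relation.Binary.Structures using (IsPartialOrder)
open import Relation.Binary.Core using (Rel)
open import Algebra.Bundles using (AbelianGroup)

record OrderedGroup (c ℓ₁ ℓ₂ : Level) : Set (Level.suc (c ⊔ ℓ₁ ⊔ ℓ₂)) where
  field
    abelianGroup : AbelianGroup c ℓ₁
  open AbelianGroup abelianGroup public
  field
    _≤G_           : Rel Carrier ℓ₂
    isPartialOrder : IsPartialOrder _≈_ _≤G_
    compatible     : ∀ {a b} c → a ≤G b → (a ∙ c) ≤G (b ∙ c)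

  infixr 8 _·_
  _·_ : ℕ → Carrier → Carrier
  zero  · x = ε
  suc n · x = x ∙ (n · x)

  -- nonempty finite subsets, represented by nonempty lists; set-level
  -- identification is imposed through the "inclusion" axiom below
  Pfe : Set c
  Pfe = List⁺ Carrier

  _∈ₛ_ : Carrier → Pfe → Set (c ⊔ ℓ₁)
  a ∈ₛ A = Any (a ≈_) (toList A)

  _⊆ₛ_ : Pfe → Pfe → Set (c ⊔ ℓ₁)
  A ⊆ₛ A' = All (_∈ₛ A') (toList A)

  _+ₛ_ : Carrier → Pfe → Pfe
  y +ₛ A = map⁺ (y ∙_) A

-- The field "sets" expresses that ⊢ is a relation on
-- finite *sets*: together with weakening it says exactly that ⊢ only
-- depends on the underlying sets (A ⊆ A' means A' = A,A' as sets).
record IsEntailment {c ℓ₁ ℓ₂ r : Level} (G : OrderedGroup c ℓ₁ ℓ₂)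
       (_⊢_ : OrderedGroup.Pfe G → OrderedGroup.Pfe G → Set r)
       : Set (c ⊔ ℓ₁ ⊔ r) where
  open OrderedGroup G
  field
    sets   : ∀ {A A' B B'} → A ⊆ₛ A' → B ⊆ₛ B' → A ⊢ B → A' ⊢ B'
    refl⊢  : ∀ a → [ a ] ⊢ [ a ]
    weaken : ∀ {A B} A' B' → A ⊢ B → (A ⁺++⁺ A') ⊢ (B ⁺++⁺ B')
    cut    : ∀ {A B} c → A ⊢ (B ⁺++⁺ [ c ]) → (A ⁺++⁺ [ c ]) ⊢ B → A ⊢ B

record IsRegularEntailment {c ℓ₁ ℓ₂ r : Level} (G : OrderedGroup c ℓ₁ ℓ₂)
       (_⊢_ : OrderedGroup.Pfe G → OrderedGroup.Pfe G → Set r)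
       : Set (c ⊔ ℓ₁ ⊔ ℓ₂ ⊔ r) where
  open OrderedGroup G
  field
    isEntailment : IsEntailment G _⊢_
    order        : ∀ {a b} → a ≤G b → [ a ] ⊢ [ b ]
    translate    : ∀ {A B} y → A ⊢ B → (y +ₛ A) ⊢ (y +ₛ B)
    exchange     : ∀ a b y z →
                   ([ y ∙ a ] ⁺++⁺ [ z ∙ b ]) ⊢ ([ z ∙ a ] ⁺++⁺ [ y ∙ b ])

-- The exchange axiom with a = y = 0 gives 0, u + v ⊢ u, v.  Cutting these along
-- x, 2x, 3x, … gives 0, nx ⊢ x for n ≥ 1, and translating by kx and cutting at each
-- k < p gives 0, qx ⊢ px whenever p ≤ q.  Translating once more by a ∈ A shows that
-- A, A + qx entails every a + px, so the elements of A + px can be cut from the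
-- hypothesis one at a time.
module Submission where

open import Defs
open import Level using (Level)
open import Function using (id; _∘′_)
open import Data.Nat using (ℕ; zero; suc; _+_; _≤_)
open import Data.Nat.Properties using (+-suc; <⇒≤; m≤n⇒∃[o]m+o≡n)
open import Data.List using (List; []; _∷_; _++_)
open import Data.List.Properties using (++-assoc)
open import Data.List.NonEmpty using ([_]; _⁺++⁺_; _⁺++_; toList)
open import Data.List.Relation.Unary.Any using (here; there)
open import Data.List.Relation.Unary.All using (All; []; _∷_; tabulateₛ)
import Data.List.Relation.Unary.All as All
import Data.List.Relation.Unary.All.Properties as All
import Data.List.Relation.Binary.Subset.Setoid as Subset
import Data.List.Relation.Binary.Equality.Setoid as Equality
open import Data.List.Relation.Binary.Pointwise using ([]; _∷_)
open import Data.List.Relation.Binary.Subset.Setoid.Properties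
  using (⊆-reflexive; ⊆-trans; xs⊆xs++ys; xs⊆ys++xs; ++⁺ʳ; ∈-∷⁺ʳ)
open import Data.List.Membership.Setoid.Properties using (∈-++⁻; ∈-++⁺ˡ; ∈-++⁺ʳ; ∈-map⁺; ∈-resp-≈)
open import Data.Product using (_,_)
open import Data.Sum using (_⊎_; [_,_]′)
import Relation.Binary.PropositionalEquality as ≡

module RegularEntailmentProperties {c ℓ₁ ℓ₂ r : Level} (G : OrderedGroup c ℓ₁ ℓ₂)
  (_⊢_ : OrderedGroup.Pfe G → OrderedGroup.Pfe G → Set r)
  (regular : IsRegularEntailment G _⊢_) where

  open OrderedGroup G
  open IsRegularEntailment regular
  open IsEntailment isEntailment
  open Subset setoid using (_⊆_)
  open Equality setoid using (_≋_; ≋-reflexive)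

  ·-homo-+ : ∀ m n x → (m + n) · x ≈ m · x ∙ n · x
  ·-homo-+ zero    n x = sym (identityˡ (n · x))
  ·-homo-+ (suc m) n x = trans (∙-congˡ (·-homo-+ m n x)) (sym (assoc x (m · x) (n · x)))

  ∈-+ₛ⁺ : ∀ {a} y A → a ∈ₛ A → (y ∙ a) ∈ₛ (y +ₛ A)
  ∈-+ₛ⁺ y A = ∈-map⁺ setoid setoid ∙-congˡ

  ++-⊆ : ∀ {xs ys zs : List Carrier} → xs ⊆ zs → ys ⊆ zs → xs ++ ys ⊆ zs
  ++-⊆ {xs} xs⊆zs ys⊆zs m = [ xs⊆zs , ys⊆zs ]′ (∈-++⁻ setoid xs m)

  ⊢-mono : ∀ {A A′ B B′} → toList A ⊆ toList A′ → toList B ⊆ toList B′ → A ⊢ B → A′ ⊢ B′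
  ⊢-mono A⊆A′ B⊆B′ = sets (tabulateₛ setoid A⊆A′) (tabulateₛ setoid B⊆B′)

  ⊢-resp-≋ : ∀ {A A′ B B′} → toList A ≋ toList A′ → toList B ≋ toList B′ → A ⊢ B → A′ ⊢ B′
  ⊢-resp-≋ A≋A′ B≋B′ = ⊢-mono (⊆-reflexive setoid A≋A′) (⊆-reflexive setoid B≋B′)

  cut₁ : ∀ {Γ B c} → Γ ⊢ [ c ] → (Γ ⁺++⁺ [ c ]) ⊢ B → Γ ⊢ B
  cut₁ {B = B} Γ⊢c = cut _ (⊢-mono id (xs⊆ys++xs setoid _ (toList B)) Γ⊢c)

  cut* : ∀ {Γ B} (C : List Carrier) → All (λ c → Γ ⊢ [ c ]) C → (Γ ⁺++ C) ⊢ B → Γ ⊢ B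
  cut* {Γ} [] [] Γ,C⊢B = ⊢-mono (++-⊆ id λ ()) id Γ,C⊢B
  cut* {Γ} (c ∷ C) (Γ⊢c ∷ Γ⊢C) Γ,C⊢B =
    cut₁ Γ⊢c (cut* C (All.map (⊢-mono (xs⊆xs++ys setoid _ _) id) Γ⊢C)
                     (⊢-mono reassociate id Γ,C⊢B))
    where
      reassociate : toList Γ ++ c ∷ C ⊆ (toList Γ ++ c ∷ []) ++ C
      reassociate = ⊆-reflexive setoid (≋-reflexive (≡.sym (++-assoc (toList Γ) (c ∷ []) C)))

  translate-pair : ∀ {u v} a → ([ ε ] ⁺++⁺ [ u ]) ⊢ [ v ] → ([ a ] ⁺++⁺ [ a ∙ u ]) ⊢ [ a ∙ v ]
  translate-pair a = ⊢-resp-≋ (identityʳ a ∷ refl ∷ []) (refl ∷ []) ∘′ translate a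

  ε,u∙v⊢u,v : ∀ u v → ([ ε ] ⁺++⁺ [ u ∙ v ]) ⊢ ([ u ] ⁺++⁺ [ v ])
  ε,u∙v⊢u,v u v =
    ⊢-resp-≋ (identityˡ ε ∷ refl ∷ []) (identityʳ u ∷ identityˡ v ∷ []) (exchange ε v ε u)

  ε,suc·x⊢x : ∀ n x → ([ ε ] ⁺++⁺ [ suc n · x ]) ⊢ [ x ]
  ε,suc·x⊢x zero    x = ⊢-mono (∈-∷⁺ʳ setoid (there (here (sym (identityʳ x)))) λ ()) id (refl⊢ x)
  ε,suc·x⊢x (suc n) x = cut (suc n · x) (ε,u∙v⊢u,v x (suc n · x)) (⊢-mono insert id (ε,suc·x⊢x n x))
    where
      insert : ε ∷ suc n · x ∷ [] ⊆ ε ∷ suc (suc n) · x ∷ suc n · x ∷ []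
      insert (here e)         = here e
      insert (there (here e)) = there (there (here e))

  ≤⇒ε,n·x⊢k·x : ∀ {k n} x → k ≤ n → ([ ε ] ⁺++⁺ [ n · x ]) ⊢ [ k · x ]
  ≤⇒ε,n·x⊢k·x {zero}      x _   = ⊢-mono (xs⊆xs++ys setoid _ _) id (refl⊢ ε)
  ≤⇒ε,n·x⊢k·x {suc k} {n} x k<n with d , ≡.refl ← m≤n⇒∃[o]m+o≡n k<n =
    cut₁ (≤⇒ε,n·x⊢k·x x (<⇒≤ k<n)) (⊢-mono swap id k·x,n·x⊢suc-k·x)
    where
      k·x∙suc-d·x≈n·x : k · x ∙ suc d · x ≈ (suc k + d) · x
      k·x∙suc-d·x≈n·x = trans (sym (·-homo-+ k (suc d) x)) (reflexive (≡.cong (_· x) (+-suc k d)))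

      k·x,n·x⊢suc-k·x : ([ k · x ] ⁺++⁺ [ (suc k + d) · x ]) ⊢ [ suc k · x ]
      k·x,n·x⊢suc-k·x = ⊢-resp-≋ (refl ∷ k·x∙suc-d·x≈n·x ∷ []) (comm (k · x) x ∷ [])
                                 (translate-pair (k · x) (ε,suc·x⊢x d x))

      swap : k · x ∷ (suc k + d) · x ∷ [] ⊆ ε ∷ (suc k + d) · x ∷ k · x ∷ []
      swap (here e)         = there (there (here e))
      swap (there (here e)) = there (here e)

  cut-middle : ∀ A B x {p q} → p ≤ q →
               (A ⁺++⁺ ((p · x) +ₛ A ⁺++⁺ (q · x) +ₛ A)) ⊢ B → (A ⁺++⁺ (q · x) +ₛ A) ⊢ B
  cut-middle A B x {p} {q} p≤q A,pA,qA⊢B =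
    cut* pA (All.map⁺ (tabulateₛ setoid A,qA⊢p·x∙a)) (⊢-mono reorder id A,pA,qA⊢B)
    where
      pA qA : List Carrier
      pA = toList ((p · x) +ₛ A)
      qA = toList ((q · x) +ₛ A)

      A,qA⊢p·x∙a : ∀ {a} → a ∈ₛ A → (A ⁺++⁺ (q · x) +ₛ A) ⊢ [ p · x ∙ a ]
      A,qA⊢p·x∙a {a} a∈A =
        ⊢-mono (∈-∷⁺ʳ setoid (∈-++⁺ˡ setoid a∈A)
                 (∈-∷⁺ʳ setoid (∈-++⁺ʳ setoid (toList A)
                                  (∈-resp-≈ setoid (comm _ _) (∈-+ₛ⁺ (q · x) A a∈A))) λ ()))
               (∈-∷⁺ʳ setoid (here (comm _ _)) λ ())
               (translate-pair a (≤⇒ε,n·x⊢k·x x p≤q))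

      reorder : toList A ++ pA ++ qA ⊆ (toList A ++ qA) ++ pA
      reorder = ++-⊆ {toList A}
                  (⊆-trans setoid (xs⊆xs++ys setoid (toList A) qA) (xs⊆xs++ys setoid (toList A ++ qA) pA))
                  (++-⊆ {pA} (xs⊆ys++xs setoid pA (toList A ++ qA))
                             (⊆-trans setoid (xs⊆ys++xs setoid qA (toList A)) (xs⊆xs++ys setoid (toList A ++ qA) pA)))

lemma2p9 : ∀ {c ℓ₁ ℓ₂ r : Level} (G : OrderedGroup c ℓ₁ ℓ₂)
             (_⊢_ : OrderedGroup.Pfe G → OrderedGroup.Pfe G → Set r) →
             IsRegularEntailment G _⊢_ →
             (A B : OrderedGroup.Pfe G) (x : OrderedGroup.Carrier G) (p q : ℕ) →
             p ≤ q →
             (((A ⁺++⁺ OrderedGroup._+ₛ_ G (OrderedGroup._·_ G p x) A) ⊢ B)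
               ⊎ ((A ⁺++⁺ (OrderedGroup._+ₛ_ G (OrderedGroup._·_ G p x) A
                     ⁺++⁺ OrderedGroup._+ₛ_ G (OrderedGroup._·_ G q x) A)) ⊢ B)) →
             (A ⁺++⁺ OrderedGroup._+ₛ_ G (OrderedGroup._·_ G q x) A) ⊢ B
lemma2p9 G _⊢_ regular A B x p q p≤q hyp =
  cut-middle A B x p≤q ([ ⊢-mono (++⁺ʳ setoid (toList A) (xs⊆xs++ys setoid _ _)) id , id ]′ hyp)
  where
    open OrderedGroup G using (setoid)
    open RegularEntailmentProperties G _⊢_ regular
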